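{- Let $p$ be a prime, $n\ge 2$, and let $L:\mathbb{F}_p^n\rightarrow\mathbb{F}_p^{n-1}$ be the linear map $L(x_1,\ldots,x_n)=(x_1+x_n,x_2+x_n,\ldots,x_{n-1}+x_n)$. Let $S_1,\ldots,S_n\subseteq\mathbb{F}_p$ with $|S_i|=k$ for $i\in[n-1]$ and $|S_n|=k'$, and suppose that $(n-1)k+k'\ge(n-1)p+1$. Then $|L(S_1,\ldots,S_n)|=p^{n-1}$.
   Context: $L(S_1,\ldots,S_n)$ denotes the image of $S_1\times\cdots\times S_n$ under $L$; $[n-1]=\{1,\ldots,n-1\}$. -}

module Defs where

open import Data.Nat using (ℕ; zero; suc; NonZero)
open import Data.Nat.Primality using (Prime)
open import Data.Fin using (Fin; toℕ; fromℕ<)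
import Data.Fin
open import Data.Fin.Subset using (Subset; _∈_)
open import Data.Fin.Subset.Properties using (_∈?_)
open import Data.List using (List; []; _∷_; map; filter; concatMap; length; allFin; deduplicate)
open import Data.Vec as V using (Vec; []; _∷_; lookup; tabulate; last; init)
open import Data.Vec.Properties using (≡-dec)
open import Data.Fin.Properties using (_≟_)
open import Data.Nat.DivMod using (_mod_)

infixl 6 _+ₚ_
_+ₚ_ : ∀ {p} .{{_ : NonZero p}} → Fin p → Fin p → Fin p
x +ₚ y = (toℕ x Data.Nat.+ toℕ y) mod _

elems : ∀ {p} → Subset p → List (Fin p)
elems S = filter (λ i → i ∈? S) (allFin _)

product : ∀ {p n} → (Fin n → Subset p) → List (Vec (Fin p) n)
product {n = zero}  S = [] ∷ []
product {n = suc n} S =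
  concatMap (λ x → map (x ∷_) (product (λ i → S (Data.Fin.suc i)))) (elems (S Data.Fin.zero))


-- L(x_1,…,x_m, x_{m+1}) = (x_1 + x_{m+1}, …, x_m + x_{m+1}),  here n = m + 1.
L : ∀ {p m} .{{_ : NonZero p}} → Vec (Fin p) (suc m) → Vec (Fin p) m
L x = V.map (λ xi → xi +ₚ last x) (init x)

imageCard : ∀ {p m} .{{_ : NonZero p}} → (Fin (suc m) → Subset p) → ℕ
imageCard S = length (deduplicate (≡-dec _≟_) (map L (product S)))

module Submission where

-- Write n = m + 1 and fix a target y ∈ 𝔽_p^m.  If t ∈ S_n is a common shift for y,
-- i.e. y_i − t ∈ S_i for every i ≤ m, then (y_1 − t, …, y_m − t, t) ∈ S_1 × ⋯ × S_n
-- is a preimage of y under L.  If no t ∈ S_n is a common shift, pick for every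
-- t ∈ S_n an index c(t) with y_{c(t)} − t ∉ S_{c(t)}; the map t ↦ (c(t), y_{c(t)} − t)
-- is injective (t is recovered from y_{c(t)} − t) and lands in the set of pairs (i, z)
-- with z ∉ S_i, which has at most m(p − k) elements.  Hence k′ ≤ m(p − k), contradicting
-- mk + k′ ≥ mp + 1.  So L maps S_1 × ⋯ × S_n onto 𝔽_p^m.

open import Defs
open import Data.Nat using (ℕ; zero; suc; _+_; _*_; _∸_; _^_; _≤_; _<_; _≥_; z≤n; s≤s; NonZero)
open import Data.Nat.Properties
open import Data.Nat.DivMod using (_%_; _mod_; %-distribˡ-+; m%n%n≡m%n; [m+n]%n≡m%n; m<n⇒m%n≡m)
open import Data.Nat.Primality using (Prime)
open import Data.Product using (∃; _×_; _,_; proj₁; proj₂)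
open import Data.Fin as F using (Fin; toℕ; fromℕ; inject₁; funToFin; finToFun)
open import Data.Fin.Properties
  using (toℕ-injective; toℕ-fromℕ<; toℕ<n; any?; all?; ¬∀⟶∃¬; funToFin-finToFin; finToFun-funToFin)
  renaming (_≟_ to _≟F_)
open import Data.Fin.Subset using (Subset; inside; outside; ∣_∣; ∁; _∉_) renaming (_∈_ to _∈ₛ_)
open import Data.Fin.Subset.Properties using (_∈?_; x∉p⇒x∈∁p; ∣∁p∣≡n∸∣p∣; ∣p∣≤n)
open import Data.List using (List; []; _∷_; length; map; filter; allFin; tabulate; concatMap)
open import Data.List.Properties using (length-++; length-map; length-tabulate; length-removeAt′)
open import Data.List.Membership.Propositional using (_∈_; _─_)
open import Data.List.Membership.Propositional.Properties
  using (∈-allFin; ∈-filter⁺; ∈-filter⁻; ∈-map⁺; ∈-concatMap⁺; ∈-deduplicate⁺)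
open import Data.List.Relation.Unary.Any as Any using (here; there)
open import Data.List.Relation.Unary.All as All using ()
open import Data.List.Relation.Unary.AllPairs using (_∷_)
open import Data.List.Relation.Unary.Unique.Propositional using (Unique)
import Data.List.Relation.Unary.Unique.Propositional.Properties as Unique
import Data.List.Relation.Unary.Unique.DecPropositional.Properties as DecUnique
open import Data.Vec as V using (Vec; []; _∷_; lookup; _∷ʳ_)
open import Data.Vec.Properties
  using (≡-dec; lookup-map; init-∷ʳ; last-∷ʳ; lookup∘tabulate; tabulate∘lookup; tabulate-cong)
open import Data.Empty using (⊥-elim)
open import Function using (_∘_)
open import Relation.Nullary using (yes; no; ¬_)
open import Relation.Nullary.Decidable using (_×-dec_)
open import Relation.Binary.PropositionalEquality

module _ {A B : Set} where

  ∈-─ : ∀ {y z : B} {ys} (y∈ : y ∈ ys) → z ∈ ys → z ≢ y → z ∈ ys ─ y∈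
  ∈-─ (here refl) (here refl) z≢y = ⊥-elim (z≢y refl)
  ∈-─ (here refl) (there z∈) _    = z∈
  ∈-─ (there y∈)  (here refl) _   = here refl
  ∈-─ (there y∈)  (there z∈) z≢y  = there (∈-─ y∈ z∈ z≢y)

  injection-length : ∀ {xs : List A} {ys : List B} (f : ∀ {a} → a ∈ xs → B) → Unique xs
    → (∀ {a b} (a∈ : a ∈ xs) (b∈ : b ∈ xs) → f a∈ ≡ f b∈ → a ≡ b)
    → (∀ {a} (a∈ : a ∈ xs) → f a∈ ∈ ys)
    → length xs ≤ length ys
  injection-length {[]}     f _          _   _    = z≤n
  injection-length {x ∷ xs} {ys} f (x∉xs ∷ u) inj into =
    subst (suc (length xs) ≤_) (sym (length-removeAt′ ys (Any.index fx∈)))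
      (s≤s (injection-length (f ∘ there) u (λ a∈ b∈ → inj (there a∈) (there b∈)) into′))
    where
    fx∈ : f (here refl) ∈ ys
    fx∈ = into (here refl)
    into′ : ∀ {a} (a∈ : a ∈ xs) → f (there a∈) ∈ ys ─ fx∈
    into′ a∈ = ∈-─ fx∈ (into (there a∈))
      (λ eq → All.lookup x∉xs a∈ (sym (inj (there a∈) (here refl) eq)))

unique-⊆-length : ∀ {A : Set} {xs ys : List A} → Unique xs → (∀ {a} → a ∈ xs → a ∈ ys) →
  length xs ≤ length ys
unique-⊆-length u sub = injection-length (λ {a} _ → a) u (λ _ _ eq → eq) sub

module Modular {p : ℕ} .{{_ : NonZero p}} where

  infixl 6 _-ₚ_
  _-ₚ_ : Fin p → Fin p → Fin p
  a -ₚ t = (toℕ a + (p ∸ toℕ t)) mod p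

  toℕ-mod-mod : ∀ x y → toℕ ((toℕ (x mod p) + y) mod p) ≡ (x + y) % p
  toℕ-mod-mod x y = begin
    toℕ ((toℕ (x mod p) + y) mod p) ≡⟨ toℕ-fromℕ< _ ⟩
    (toℕ (x mod p) + y) % p         ≡⟨ cong (λ z → (z + y) % p) (toℕ-fromℕ< _) ⟩
    (x % p + y) % p                 ≡⟨ %-distribˡ-+ (x % p) y p ⟩
    (x % p % p + y % p) % p         ≡⟨ cong (λ z → (z + y % p) % p) (m%n%n≡m%n x p) ⟩
    (x % p + y % p) % p             ≡⟨ sym (%-distribˡ-+ x y p) ⟩
    (x + y) % p                     ∎
    where open ≡-Reasoning

  add-complement : (a : Fin p) (u v : ℕ) → u + v ≡ p → (toℕ a + u + v) % p ≡ toℕ a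
  add-complement a u v u+v≡p = begin
    (toℕ a + u + v) % p   ≡⟨ cong (_% p) (+-assoc (toℕ a) u v) ⟩
    (toℕ a + (u + v)) % p ≡⟨ cong (λ w → (toℕ a + w) % p) u+v≡p ⟩
    (toℕ a + p) % p       ≡⟨ [m+n]%n≡m%n (toℕ a) p ⟩
    toℕ a % p             ≡⟨ m<n⇒m%n≡m (toℕ<n a) ⟩
    toℕ a                 ∎
    where open ≡-Reasoning

  sub-add : (a t : Fin p) → a -ₚ t +ₚ t ≡ a
  sub-add a t = toℕ-injective (trans (toℕ-mod-mod (toℕ a + (p ∸ toℕ t)) (toℕ t))
    (add-complement a (p ∸ toℕ t) (toℕ t) (m∸n+n≡m (<⇒≤ (toℕ<n t)))))

  add-sub : (a t : Fin p) → a +ₚ t -ₚ t ≡ a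
  add-sub a t = toℕ-injective (trans (toℕ-mod-mod (toℕ a + toℕ t) (p ∸ toℕ t))
    (add-complement a (toℕ t) (p ∸ toℕ t) (m+[n∸m]≡n (<⇒≤ (toℕ<n t)))))

  +ₚ-comm : (a b : Fin p) → a +ₚ b ≡ b +ₚ a
  +ₚ-comm a b = cong (_mod p) (+-comm (toℕ a) (toℕ b))

  +ₚ-cancelʳ : ∀ {a b} t → a +ₚ t ≡ b +ₚ t → a ≡ b
  +ₚ-cancelʳ {a} {b} t eq = trans (sym (add-sub a t)) (trans (cong (_-ₚ t) eq) (add-sub b t))

  -- t is determined by a − t: this is what makes the pigeonhole map injective.
  sub-injective : (a : Fin p) {t t′ : Fin p} → a -ₚ t ≡ a -ₚ t′ → t ≡ t′
  sub-injective a {t} {t′} eq = +ₚ-cancelʳ (a -ₚ t) (begin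
    t +ₚ (a -ₚ t)      ≡⟨ +ₚ-comm t _ ⟩
    a -ₚ t +ₚ t        ≡⟨ sub-add a t ⟩
    a                  ≡⟨ sym (sub-add a t′) ⟩
    a -ₚ t′ +ₚ t′      ≡⟨ cong (_+ₚ t′) (sym eq) ⟩
    a -ₚ t +ₚ t′       ≡⟨ +ₚ-comm _ t′ ⟩
    t′ +ₚ (a -ₚ t)     ∎)
    where open ≡-Reasoning

  map-sub-add : ∀ {m} (y : Vec (Fin p) m) t → V.map (_+ₚ t) (V.map (_-ₚ t) y) ≡ y
  map-sub-add []      t = refl
  map-sub-add (a ∷ y) t = cong₂ _∷_ (sub-add a t) (map-sub-add y t)

open Modular

filter-suc : ∀ {n p} b (S : Subset p) (f : Fin n → Fin p) →
  length (filter (_∈? (b ∷ S)) (tabulate (F.suc ∘ f))) ≡ length (filter (_∈? S) (tabulate f))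
filter-suc {zero}  b S f = refl
filter-suc {suc n} b S f with f F.zero ∈? S
... | yes _ = cong suc (filter-suc b S (f ∘ F.suc))
... | no _  = filter-suc b S (f ∘ F.suc)

elems-length : ∀ {p} (S : Subset p) → length (elems S) ≡ ∣ S ∣
elems-length []            = refl
elems-length (inside ∷ S)  = cong suc (trans (filter-suc _ S (λ i → i)) (elems-length S))
elems-length (outside ∷ S) = trans (filter-suc _ S (λ i → i)) (elems-length S)

∈-elems : ∀ {p} {S : Subset p} {t} → t ∈ₛ S → t ∈ elems S
∈-elems {t = t} t∈S = ∈-filter⁺ (_∈? _) (∈-allFin t) t∈S

elems-unique : ∀ {p} (S : Subset p) → Unique (elems S)
elems-unique {p} S = Unique.filter⁺ (_∈? S) (Unique.allFin⁺ p)

∈-product-snoc : ∀ {p m} (S : Fin (suc m) → Subset p) (v : Vec (Fin p) m) t →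
  (∀ i → lookup v i ∈ₛ S (inject₁ i)) → t ∈ₛ S (fromℕ m) → v ∷ʳ t ∈ product S
∈-product-snoc {m = zero}  S []      t _  t∈S =
  ∈-concatMap⁺ _ (Any.map (λ { refl → here refl }) (∈-elems t∈S))
∈-product-snoc {m = suc m} S (a ∷ v) t v∈ t∈S =
  ∈-concatMap⁺ _ (Any.map (λ { refl → ∈-map⁺ (a ∷_) tail∈ }) (∈-elems (v∈ F.zero)))
  where
  tail∈ : v ∷ʳ t ∈ product (S ∘ F.suc)
  tail∈ = ∈-product-snoc (S ∘ F.suc) v t (v∈ ∘ F.suc) t∈S

length-concatMap-≤ : ∀ {X B : Set} {m} (g : Fin m → X) (f : X → List B) c →
  (∀ x → length (f x) ≤ c) → length (concatMap f (tabulate g)) ≤ m * c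
length-concatMap-≤ {m = zero}  g f c bound = z≤n
length-concatMap-≤ {m = suc m} g f c bound = ≤-trans (≤-reflexive (length-++ (f (g F.zero))))
  (+-mono-≤ (bound _) (length-concatMap-≤ (g ∘ F.suc) f c bound))

-- funToFin respects pointwise equality (needed in the absence of function extensionality).
funToFin-cong : ∀ {m n} {f g : Fin m → Fin n} → (∀ i → f i ≡ g i) → funToFin f ≡ funToFin g
funToFin-cong {zero}  eq = refl
funToFin-cong {suc m} eq = cong₂ F.combine (eq F.zero) (funToFin-cong (eq ∘ F.suc))

allVecs : ∀ p m → List (Vec (Fin p) m)
allVecs p m = map (V.tabulate ∘ finToFun) (allFin (p ^ m))

allVecs-length : ∀ p m → length (allVecs p m) ≡ p ^ m
allVecs-length p m = trans (length-map _ (allFin (p ^ m))) (length-tabulate (λ i → i))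

allVecs-unique : ∀ p m → Unique (allVecs p m)
allVecs-unique p m = Unique.map⁺ injective (Unique.allFin⁺ (p ^ m))
  where
  injective : ∀ {k k′} → V.tabulate (finToFun {p} {m} k) ≡ V.tabulate (finToFun k′) → k ≡ k′
  injective {k} {k′} eq = trans (sym (funToFin-finToFin {m} {p} k)) (trans
    (funToFin-cong (λ i → trans (sym (lookup∘tabulate (finToFun k) i))
       (trans (cong (λ v → lookup v i) eq) (lookup∘tabulate (finToFun k′) i))))
    (funToFin-finToFin {m} {p} k′))

∈-allVecs : ∀ p m (v : Vec (Fin p) m) → v ∈ allVecs p m
∈-allVecs p m v = subst (_∈ allVecs p m) decode (∈-map⁺ _ (∈-allFin (funToFin (lookup v))))
  where
  decode : V.tabulate (finToFun (funToFin (lookup v))) ≡ v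
  decode = trans (tabulate-cong (finToFun-funToFin (lookup v))) (tabulate∘lookup v)

complete-unique-length : ∀ {p m} {vs : List (Vec (Fin p) m)} → Unique vs →
  (∀ v → v ∈ vs) → length vs ≡ p ^ m
complete-unique-length {p} {m} {vs} u complete = ≤-antisym
  (subst (length vs ≤_) (allVecs-length p m)
    (unique-⊆-length {ys = allVecs p m} u (λ {v} _ → ∈-allVecs p m v)))
  (subst (_≤ length vs) (allVecs-length p m)
    (unique-⊆-length {ys = vs} (allVecs-unique p m) (λ {v} _ → complete v)))

module Surjectivity {p m : ℕ} .{{_ : NonZero p}} (S : Fin (suc m) → Subset p) where

  CommonShift : Vec (Fin p) m → Fin p → Set
  CommonShift y t = ∀ i → lookup y i -ₚ t ∈ₛ S (inject₁ i)

  shift-preimage : ∀ y t → t ∈ₛ S (fromℕ m) → CommonShift y t → y ∈ map L (product S)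
  shift-preimage y t t∈S shift = subst (_∈ map L (product S)) L-x≡y (∈-map⁺ L x∈product)
    where
    v : Vec (Fin p) m
    v = V.map (_-ₚ t) y
    x∈product : v ∷ʳ t ∈ product S
    x∈product = ∈-product-snoc S v t
      (λ i → subst (_∈ₛ S (inject₁ i)) (sym (lookup-map i _ y)) (shift i)) t∈S
    L-x≡y : L (v ∷ʳ t) ≡ y
    L-x≡y = trans (cong₂ (λ a w → V.map (_+ₚ a) w) (last-∷ʳ t v) (init-∷ʳ t v)) (map-sub-add y t)

  deficient : Fin m → List (Fin m × Fin p)
  deficient i = map (i ,_) (elems (∁ (S (inject₁ i))))

  deficiencies : List (Fin m × Fin p)
  deficiencies = concatMap deficient (allFin m)

  ∈-deficiencies : ∀ {i z} → z ∉ S (inject₁ i) → (i , z) ∈ deficiencies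
  ∈-deficiencies {i} z∉S = ∈-concatMap⁺ _
    (Any.map (λ { refl → ∈-map⁺ (i ,_) (∈-elems (x∉p⇒x∈∁p z∉S)) }) (∈-allFin i))

  deficiencies-length : ∀ k → (∀ i → k ≤ ∣ S (inject₁ i) ∣) → length deficiencies ≤ m * (p ∸ k)
  deficiencies-length k large = length-concatMap-≤ (λ i → i) deficient (p ∸ k) (λ i → begin
    length (deficient i)                            ≡⟨ length-map (i ,_) (elems (∁ (S (inject₁ i)))) ⟩
    length (elems (∁ (S (inject₁ i))))              ≡⟨ elems-length (∁ (S (inject₁ i))) ⟩
    ∣ ∁ (S (inject₁ i)) ∣                          ≡⟨ ∣∁p∣≡n∸∣p∣ (S (inject₁ i)) ⟩
    p ∸ ∣ S (inject₁ i) ∣                          ≤⟨ ∸-monoʳ-≤ p (large i) ⟩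
    p ∸ k                                          ∎)
    where open ≤-Reasoning

  no-shift-bound : ∀ y → (∀ t → t ∈ₛ S (fromℕ m) → ¬ CommonShift y t) →
    ∣ S (fromℕ m) ∣ ≤ length deficiencies
  no-shift-bound y noShift = subst (_≤ length deficiencies) (elems-length (S (fromℕ m)))
    (injection-length φ (elems-unique (S (fromℕ m))) φ-injective
      (λ t∈ → ∈-deficiencies (proj₂ (failure t∈))))
    where
    failure : ∀ {t} → t ∈ elems (S (fromℕ m)) → ∃ λ i → lookup y i -ₚ t ∉ S (inject₁ i)
    failure {t} t∈ = ¬∀⟶∃¬ m _ (λ i → lookup y i -ₚ t ∈? S (inject₁ i))
      (noShift t (proj₂ (∈-filter⁻ (_∈? S (fromℕ m)) {xs = allFin p} t∈)))
    φ : ∀ {t} → t ∈ elems (S (fromℕ m)) → Fin m × Fin p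
    φ {t} t∈ = proj₁ (failure t∈) , lookup y (proj₁ (failure t∈)) -ₚ t
    φ-injective : ∀ {t t′} (t∈ : t ∈ elems (S (fromℕ m))) (t′∈ : t′ ∈ elems (S (fromℕ m))) →
      φ t∈ ≡ φ t′∈ → t ≡ t′
    φ-injective {t′ = t′} t∈ t′∈ eq = sub-injective (lookup y (proj₁ (failure t∈)))
      (trans (cong proj₂ eq) (cong (λ i → lookup y i -ₚ t′) (sym (cong proj₁ eq))))

  L-onto : ∀ k → (∀ i → k ≤ ∣ S (inject₁ i) ∣) → m * (p ∸ k) < ∣ S (fromℕ m) ∣ →
    ∀ y → y ∈ map L (product S)
  L-onto k large big y
    with any? (λ t → t ∈? S (fromℕ m) ×-dec all? (λ i → lookup y i -ₚ t ∈? S (inject₁ i)))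
  ... | yes (t , t∈S , shift) = shift-preimage y t t∈S shift
  ... | no noShift = ⊥-elim (<⇒≱ big (≤-trans
          (no-shift-bound y (λ t t∈S shift → noShift (t , t∈S , shift)))
          (deficiencies-length k large)))

open Surjectivity using (L-onto)

deficiency-bound : ∀ m p k k′ → k ≤ p → m * k + k′ ≥ m * p + 1 → m * (p ∸ k) < k′
deficiency-bound m p k k′ k≤p hyp = +-cancelˡ-≤ (m * k) _ _ (begin
  m * k + suc (m * (p ∸ k)) ≡⟨ +-suc (m * k) _ ⟩
  suc (m * k + m * (p ∸ k)) ≡⟨ cong suc (sym (*-distribˡ-+ m k (p ∸ k))) ⟩
  suc (m * (k + (p ∸ k)))   ≡⟨ cong (λ q → suc (m * q)) (m+[n∸m]≡n k≤p) ⟩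
  suc (m * p)               ≡⟨ +-comm 1 (m * p) ⟩
  m * p + 1                 ≤⟨ hyp ⟩
  m * k + k′                ∎)
  where open ≤-Reasoning

claim1 : (p : ℕ) .{{_ : NonZero p}} → Prime p → (m : ℕ) → 1 ≤ m → (k k′ : ℕ)
    → (S : Fin (suc m) → Subset p)
    → ((i : Fin m) → ∣ S (inject₁ i) ∣ ≡ k) → ∣ S (fromℕ m) ∣ ≡ k′
    → m * k + k′ ≥ m * p + 1
    → imageCard S ≡ p ^ m
claim1 p _ m@(suc _) _ k k′ S sizes size-n hyp =
  complete-unique-length (DecUnique.deduplicate-! (≡-dec _≟F_) (map L (product S)))
    (λ y → ∈-deduplicate⁺ (≡-dec _≟F_) (L-onto S k (λ i → ≤-reflexive (sym (sizes i))) big y))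
  where
  k≤p : k ≤ p
  k≤p = subst (_≤ p) (sizes F.zero) (∣p∣≤n (S (inject₁ F.zero)))
  big : m * (p ∸ k) < ∣ S (fromℕ m) ∣
  big = subst (m * (p ∸ k) <_) (sym size-n) (deficiency-bound m p k k′ k≤p hyp)
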